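{- $\mathsf{Cnf}$ has unique addition, unique multiplication and unique exponentiation with base $\omega$.
   Context: Work in homotopy type theory. Let $\mathcal T$ be the inductive type of unlabeled binary trees with constructors $0$ (leaf) and $\omega^a + b$ (node with left subtree $a$, right subtree $b$). The order $<$ on $\mathcal T$ is the lexicographic order generated by $0 < \omega^a+b$; $a<c \to \omega^a+b < \omega^c+d$; $b<d \to \omega^a+b<\omega^a+d$, and $\leq$ is its reflexive closure. Let $\mathsf{left}(0)=0$, $\mathsf{left}(\omega^a+b)=a$. A tree is a Cantor normal form (CNF) if for every node $\omega^s+t$ it contains we have $\mathsf{left}(t)\le s$; $\mathsf{Cnf}$ is the type of CNFs. Addition on CNFs: $0+b=b$, $a+0=a$, $(\omega^a+c)+(\omega^b+d) = \omega^b+d$ if $a<b$ and $\omega^a+(c+(\omega^b+d))$ otherwise. Multiplication: $0\cdot b=0$, $a\cdot 0=0$, $a\cdot(\omega^0+d)=a+a\cdot d$, $(\omega^a+c)\cdot(\omega^b+d)=\omega^{a+b}+0+(\omega^a+c)\cdot d$ if $b\ne 0$. Exponentiation with base $\omega$ sends $a$ to the tree $\omega^a+0$, and $\omega := \omega^1+0$ where $1:=\omega^0+0$. Definitions: $a$ is zero if $\forall b.\, a\le b$; $a$ is a successor of $b$ if $b<a$ and $\forall x>b.\, x\ge a$; $a$ is a supremum of $f:\mathbb N\to A$ if $\forall i.\, f_i\le a$ and every $x$ with $\forall i.\, f_i\le x$ satisfies $a\le x$; $a$ is the limit of a strictly increasing sequence $f$ if it is its supremum. $A$ has addition if there is $+:A\to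 A\to A$ with: $a$ zero $\to c+a=c$; ($a$ successor of $b$) $\to$ ($d$ successor of $c+b$) $\to c+a=d$; ($a$ limit of $f$) $\to$ ($b$ supremum of $\lambda i.\,c+f_i$) $\to c+a=b$; it has unique addition if exactly one such function exists. $A$ has multiplication (given addition) if there is $\cdot$ with: $a$ zero $\to c\cdot a=a$; ($a$ successor of $b$) $\to c\cdot a=c\cdot b+c$; ($a$ limit of $f$) $\to$ ($b$ supremum of $\lambda i.\,c\cdot f_i$) $\to c\cdot a=b$; unique multiplication means unique addition and exactly one such $\cdot$. $A$ has exponentiation with base $c$ if there is $\exp(c,-)$ with: ($b$ zero) $\to$ ($a$ successor of $b$) $\to \exp(c,b)=a$; ($a$ successor of $b$) $\to \exp(c,a)=\exp(c,b)\cdot c$; ($a$ limit of $f$) $\to c$ not zero $\to$ ($b$ supremum of $\lambda i.\exp(c,f_i)$) $\to \exp(c,a)=b$; ($a$ limit of $f$) $\to c$ zero $\to \exp(c,a)=c$; unique means unique addition and multiplication and $\exp(c,-)$ unique. -}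

module Defs where

open import Data.Nat using (ℕ; suc)
open import Data.Product using (Σ; _×_; _,_; proj₁; proj₂)
open import Data.Sum using (_⊎_)
open import Relation.Binary.PropositionalEquality using (_≡_)
open import Relation.Nullary using (¬_)

infixr 30 ω^_+_
data Tree : Set where
  𝟎     : Tree
  ω^_+_ : Tree → Tree → Tree

infix 4 _<ᵀ_ _≤ᵀ_
data _<ᵀ_ : Tree → Tree → Set where
  <₁ : ∀ {a b} → 𝟎 <ᵀ ω^ a + b
  <₂ : ∀ {a b c d} → a <ᵀ c → ω^ a + b <ᵀ ω^ c + d
  <₃ : ∀ {a b d} → b <ᵀ d → ω^ a + b <ᵀ ω^ a + d

_≤ᵀ_ : Tree → Tree → Set
a ≤ᵀ b = (a <ᵀ b) ⊎ (a ≡ b)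

left : Tree → Tree
left 𝟎 = 𝟎
left (ω^ a + b) = a

data IsCnf : Tree → Set where
  cnf𝟎 : IsCnf 𝟎
  cnfω : ∀ {s t} → IsCnf s → IsCnf t → left t ≤ᵀ s → IsCnf (ω^ s + t)

Cnf : Set
Cnf = Σ Tree IsCnf

_<_ : Cnf → Cnf → Set
a < b = proj₁ a <ᵀ proj₁ b

_≤_ : Cnf → Cnf → Set
a ≤ b = proj₁ a ≤ᵀ proj₁ b

𝟏ᵀ : Tree
𝟏ᵀ = ω^ 𝟎 + 𝟎

ω : Cnf
ω = ω^ 𝟏ᵀ + 𝟎 , cnfω (cnfω cnf𝟎 cnf𝟎 (Data.Sum.inj₂ _≡_.refl)) cnf𝟎 (Data.Sum.inj₁ <₁)

module Notions {A : Set} (_≺_ : A → A → Set) (_≼_ : A → A → Set) where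

  IsZero : A → Set
  IsZero a = ∀ b → a ≼ b

  IsSuc : A → A → Set
  IsSuc a b = (b ≺ a) × (∀ x → b ≺ x → a ≼ x)

  IsSup : A → (ℕ → A) → Set
  IsSup a f = (∀ i → f i ≼ a) × (∀ x → (∀ i → f i ≼ x) → a ≼ x)

  StrictlyIncreasing : (ℕ → A) → Set
  StrictlyIncreasing f = ∀ i → f i ≺ f (suc i)

  IsLimit : A → (ℕ → A) → Set
  IsLimit a f = StrictlyIncreasing f × IsSup a f

  IsAddition : (A → A → A) → Set
  IsAddition _+_ =
      (∀ a c → IsZero a → c + a ≡ c)
    × (∀ a b c d → IsSuc a b → IsSuc d (c + b) → c + a ≡ d)
    × (∀ a f c b → IsLimit a f → IsSup b (λ i → c + f i) → c + a ≡ b)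

  IsMultiplication : (A → A → A) → (A → A → A) → Set
  IsMultiplication _+_ _·_ =
      (∀ a c → IsZero a → c · a ≡ a)
    × (∀ a b c → IsSuc a b → c · a ≡ (c · b) + c)
    × (∀ a f c b → IsLimit a f → IsSup b (λ i → c · f i) → c · a ≡ b)

  IsExponentiation : (A → A → A) → A → (A → A) → Set
  IsExponentiation _·_ c e =
      (∀ a b → IsZero b → IsSuc a b → e b ≡ a)
    × (∀ a b → IsSuc a b → e a ≡ e b · c)
    × (∀ a f b → IsLimit a f → ¬ IsZero c → IsSup b (λ i → e (f i)) → e a ≡ b)
    × (∀ a f → IsLimit a f → IsZero c → e a ≡ c)

  HasUniqueAddition : Set
  HasUniqueAddition =
    Σ (A → A → A) λ _+_ → IsAddition _+_
      × (∀ g → IsAddition g → ∀ x y → g x y ≡ x + y)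

  HasUniqueMultiplication : Set
  HasUniqueMultiplication =
    Σ HasUniqueAddition λ add →
      Σ (A → A → A) λ _·_ → IsMultiplication (proj₁ add) _·_
        × (∀ g → IsMultiplication (proj₁ add) g → ∀ x y → g x y ≡ x · y)

  HasUniqueExponentiation : A → Set
  HasUniqueExponentiation c =
    Σ HasUniqueMultiplication λ mul →
      Σ (A → A) λ e → IsExponentiation (proj₁ (proj₂ mul)) c e
        × (∀ g → IsExponentiation (proj₁ (proj₂ mul)) c g → ∀ x → g x ≡ e x)

open Notions _<_ _≤_ public

-- Uniqueness: in a well-founded order where every element is zero, a successor or a limit,
-- two functions obeying the zero, successor and limit equations agree by transfinite
-- induction, provided one of them is continuous (sends limits to suprema). CNFs are such an
-- order, and the tree operations obey the zero and successor equations by computation, so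
-- everything comes down to their continuity. For addition, an upper bound z of all c + f i
-- is c + d for some d bounding the f i; for multiplication, anything below c · a already lies
-- below c · (q + 1) for some q < a; for ω^_, suprema are read off leading exponents.
module Submission where

open import Data.Empty using (⊥-elim)
open import Data.Nat using (ℕ; zero; suc)
open import Data.Product using (Σ-syntax; _×_; _,_; proj₁; proj₂)
open import Data.Sum using (inj₁; inj₂)
open import Induction.WellFounded using (WellFounded; Acc; acc; module All)
open import Relation.Binary.Definitions using (Irreflexive; Trichotomous; Tri; tri<; tri≈; tri>)
import Relation.Binary.Definitions as Binary
open import Relation.Binary.Structures using (IsStrictTotalOrder)
open import Relation.Binary.PropositionalEquality
  using (_≡_; _≗_; refl; sym; trans; cong; subst; isEquivalence; resp₂)
open import Relation.Nullary using (¬_; yes; no)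
import Relation.Unary as Unary
import Axiom.UniquenessOfIdentityProofs as UIP

-- Reopened at Cnf below, after Characterisation has applied Notions to its own parameters.
open import Defs hiding
  ( IsZero; IsSuc; IsSup; StrictlyIncreasing; IsLimit; IsAddition; IsMultiplication
  ; IsExponentiation; HasUniqueAddition; HasUniqueMultiplication; HasUniqueExponentiation )
import Relation.Binary.Construct.StrictToNonStrict _≡_ _<ᵀ_ as NonStrict

module Characterisation {A : Set} (_≺_ _≼_ : A → A → Set) where
  open Notions _≺_ _≼_

  data Classification (a : A) : Set where
    isZero  : IsZero a → Classification a
    isSuc   : ∀ b → IsSuc a b → Classification a
    isLimit : ∀ f → IsLimit a f → Classification a

  Continuous : (A → A) → Set
  Continuous F = ∀ a f → IsLimit a f → IsSup (F a) (λ i → F (f i))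

  IsSup-resp-≗ : ∀ {a f g} → f ≗ g → IsSup a f → IsSup a g
  IsSup-resp-≗ {a} f≗g (upper , least) =
      (λ i → subst (_≼ a) (f≗g i) (upper i))
    , (λ x g≼x → least x (λ i → subst (_≼ x) (sym (f≗g i)) (g≼x i)))

  module Successors (≼-antisym : ∀ {x y} → x ≼ y → y ≼ x → x ≡ y)
                    (succ : A → A)
                    (succ-isSuc : ∀ a → IsSuc (succ a) a)
                    where

    isSuc⇒≡succ : ∀ {a b} → IsSuc a b → a ≡ succ b
    isSuc⇒≡succ {b = b} (b≺a , a-least) =
      ≼-antisym (a-least (succ b) (proj₁ (succ-isSuc b))) (proj₂ (succ-isSuc b) _ b≺a)

    IsSup-unique : ∀ {a b f} → IsSup a f → IsSup b f → a ≡ b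
    IsSup-unique {a} {b} (a-upper , a-least) (b-upper , b-least) =
      ≼-antisym (a-least b b-upper) (b-least a a-upper)

    module Uniqueness (≺-≼-trans : ∀ {x y z} → x ≺ y → y ≼ z → x ≺ z)
                      (≺-wellFounded : WellFounded _≺_)
                      (classify : ∀ a → Classification a)
                      where

      transfinite-induction : (P : A → Set) →
        (∀ a → IsZero a → P a) →
        (∀ a b → IsSuc a b → P b → P a) →
        (∀ a f → IsLimit a f → (∀ i → P (f i)) → P a) →
        ∀ a → P a
      transfinite-induction P P-zero P-suc P-limit = All.wfRec ≺-wellFounded _ P step
        where
        step : ∀ a → (∀ {b} → b ≺ a → P b) → P a
        step a IH with classify a
        ... | isZero a-zero = P-zero a a-zero
        ... | isSuc b a-suc = P-suc a b a-suc (IH (proj₁ a-suc))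
        ... | isLimit f a-limit@(f-increasing , f-upper , _) =
          P-limit a f a-limit λ i → IH (≺-≼-trans (f-increasing i) (f-upper (suc i)))

      hasUniqueAddition : (_+_ : A → A → A) →
        (∀ a c → IsZero a → c + a ≡ c) →
        (∀ c b → c + succ b ≡ succ (c + b)) →
        (∀ c → Continuous (c +_)) →
        HasUniqueAddition
      hasUniqueAddition _+_ +-zero +-succ +-continuous =
        _+_ , (+-zero , suc-clause , limit-clause) , unique
        where
        +-isSuc : ∀ {a b} c → IsSuc a b → c + a ≡ succ (c + b)
        +-isSuc {b = b} c a-suc = trans (cong (c +_) (isSuc⇒≡succ a-suc)) (+-succ c b)

        suc-clause : ∀ a b c d → IsSuc a b → IsSuc d (c + b) → c + a ≡ d
        suc-clause a b c d a-suc d-suc = trans (+-isSuc c a-suc) (sym (isSuc⇒≡succ d-suc))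

        limit-clause : ∀ a f c b → IsLimit a f → IsSup b (λ i → c + f i) → c + a ≡ b
        limit-clause a f c b a-limit = IsSup-unique (+-continuous c a f a-limit)

        unique : ∀ g → IsAddition g → ∀ c a → g c a ≡ c + a
        unique g (g-zero , g-suc , g-limit) c = transfinite-induction (λ a → g c a ≡ c + a)
          (λ a a-zero → trans (g-zero a c a-zero) (sym (+-zero a c a-zero)))
          (λ a b a-suc g≡+ → trans
            (g-suc a b c _ a-suc (subst (IsSuc _) (sym g≡+) (succ-isSuc (c + b))))
            (sym (+-isSuc c a-suc)))
          (λ a f a-limit g≡+ → g-limit a f c (c + a) a-limit
            (IsSup-resp-≗ (λ i → sym (g≡+ i)) (+-continuous c a f a-limit)))

      hasUniqueMultiplication : (add : HasUniqueAddition) → let _+_ = proj₁ add in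
        (_·_ : A → A → A) →
        (∀ a c → IsZero a → c · a ≡ a) →
        (∀ c b → c · succ b ≡ (c · b) + c) →
        (∀ c → Continuous (c ·_)) →
        HasUniqueMultiplication
      hasUniqueMultiplication add@(_+_ , _) _·_ ·-zero ·-succ ·-continuous =
        add , _·_ , (·-zero , suc-clause , limit-clause) , unique
        where
        suc-clause : ∀ a b c → IsSuc a b → c · a ≡ (c · b) + c
        suc-clause a b c a-suc = trans (cong (c ·_) (isSuc⇒≡succ a-suc)) (·-succ c b)

        limit-clause : ∀ a f c b → IsLimit a f → IsSup b (λ i → c · f i) → c · a ≡ b
        limit-clause a f c b a-limit = IsSup-unique (·-continuous c a f a-limit)

        unique : ∀ g → IsMultiplication _+_ g → ∀ c a → g c a ≡ c · a
        unique g (g-zero , g-suc , g-limit) c = transfinite-induction (λ a → g c a ≡ c · a)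
          (λ a a-zero → trans (g-zero a c a-zero) (sym (·-zero a c a-zero)))
          (λ a b a-suc g≡· → trans (g-suc a b c a-suc)
            (trans (cong (_+ c) g≡·) (sym (suc-clause a b c a-suc))))
          (λ a f a-limit g≡· → g-limit a f c (c · a) a-limit
            (IsSup-resp-≗ (λ i → sym (g≡· i)) (·-continuous c a f a-limit)))

      hasUniqueExponentiation : (mul : HasUniqueMultiplication) → let _·_ = proj₁ (proj₂ mul) in
        ∀ c → ¬ IsZero c → (e : A → A) →
        (∀ b → IsZero b → e b ≡ succ b) →
        (∀ b → e (succ b) ≡ e b · c) →
        Continuous e →
        HasUniqueExponentiation c
      hasUniqueExponentiation mul@(_ , _·_ , _) c c-nonzero e e-zero e-succ e-continuous =
        mul , e , (zero-clause , suc-clause , limit-clause , zero-base-clause) , unique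
        where
        zero-clause : ∀ a b → IsZero b → IsSuc a b → e b ≡ a
        zero-clause a b b-zero a-suc = trans (e-zero b b-zero) (sym (isSuc⇒≡succ a-suc))

        suc-clause : ∀ a b → IsSuc a b → e a ≡ e b · c
        suc-clause a b a-suc = trans (cong e (isSuc⇒≡succ a-suc)) (e-succ b)

        limit-clause : ∀ a f b → IsLimit a f → ¬ IsZero c → IsSup b (λ i → e (f i)) → e a ≡ b
        limit-clause a f b a-limit _ = IsSup-unique (e-continuous a f a-limit)

        zero-base-clause : ∀ a f → IsLimit a f → IsZero c → e a ≡ c
        zero-base-clause _ _ _ c-zero = ⊥-elim (c-nonzero c-zero)

        unique : ∀ g → IsExponentiation _·_ c g → ∀ a → g a ≡ e a
        unique g (g-zero , g-suc , g-limit , _) = transfinite-induction (λ a → g a ≡ e a)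
          (λ a a-zero → trans (g-zero (succ a) a a-zero (succ-isSuc a)) (sym (e-zero a a-zero)))
          (λ a b a-suc g≡e → trans (g-suc a b a-suc)
            (trans (cong (_· c) g≡e) (sym (suc-clause a b a-suc))))
          (λ a f a-limit g≡e → g-limit a f (e a) a-limit c-nonzero
            (IsSup-resp-≗ (λ i → sym (g≡e i)) (e-continuous a f a-limit)))

open Notions _<_ _≤_

-- The order on trees

<-irrefl : Irreflexive _≡_ _<ᵀ_
<-irrefl refl (<₂ p) = <-irrefl refl p
<-irrefl refl (<₃ p) = <-irrefl refl p

<-trans : ∀ {a b c} → a <ᵀ b → b <ᵀ c → a <ᵀ c
<-trans <₁     (<₂ _) = <₁
<-trans <₁     (<₃ _) = <₁
<-trans (<₂ p) (<₂ q) = <₂ (<-trans p q)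
<-trans (<₂ p) (<₃ _) = <₂ p
<-trans (<₃ _) (<₂ q) = <₂ q
<-trans (<₃ p) (<₃ q) = <₃ (<-trans p q)

<-asym : ∀ {a b} → a <ᵀ b → ¬ (b <ᵀ a)
<-asym p q = <-irrefl refl (<-trans p q)

<⇒tri< : ∀ {a b} → a <ᵀ b → Tri (a <ᵀ b) (a ≡ b) (b <ᵀ a)
<⇒tri< p = tri< p (λ { refl → <-irrefl refl p }) (<-asym p)

>⇒tri> : ∀ {a b} → b <ᵀ a → Tri (a <ᵀ b) (a ≡ b) (b <ᵀ a)
>⇒tri> p = tri> (<-asym p) (λ { refl → <-irrefl refl p }) p

<-cmp : Trichotomous _≡_ _<ᵀ_
<-cmp 𝟎 𝟎 = tri≈ (<-irrefl refl) refl (<-irrefl refl)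
<-cmp 𝟎 (ω^ _ + _) = <⇒tri< <₁
<-cmp (ω^ _ + _) 𝟎 = >⇒tri> <₁
<-cmp (ω^ a + b) (ω^ c + d) with <-cmp a c
... | tri< a<c _ _ = <⇒tri< (<₂ a<c)
... | tri> _ _ c<a = >⇒tri> (<₂ c<a)
... | tri≈ _ refl _ with <-cmp b d
...   | tri< b<d _ _ = <⇒tri< (<₃ b<d)
...   | tri> _ _ d<b = >⇒tri> (<₃ d<b)
...   | tri≈ _ refl _ = tri≈ (<-irrefl refl) refl (<-irrefl refl)

<-isStrictTotalOrder : IsStrictTotalOrder _≡_ _<ᵀ_
<-isStrictTotalOrder = record
  { isStrictPartialOrder = record
    { isEquivalence = isEquivalence
    ; irrefl        = <-irrefl
    ; trans         = <-trans
    ; <-resp-≈      = resp₂ _<ᵀ_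
    }
  ; compare = <-cmp
  }

open IsStrictTotalOrder <-isStrictTotalOrder using (_<?_; _≟_)

≤-trans : ∀ {a b c} → a ≤ᵀ b → b ≤ᵀ c → a ≤ᵀ c
≤-trans = NonStrict.trans isEquivalence (resp₂ _<ᵀ_) <-trans

≤-antisym : ∀ {a b} → a ≤ᵀ b → b ≤ᵀ a → a ≡ b
≤-antisym = NonStrict.antisym isEquivalence <-trans <-irrefl

<-≤-trans : ∀ {a b c} → a <ᵀ b → b ≤ᵀ c → a <ᵀ c
<-≤-trans = NonStrict.<-≤-trans <-trans (proj₁ (resp₂ _<ᵀ_))

≤-<-trans : ∀ {a b c} → a ≤ᵀ b → b <ᵀ c → a <ᵀ c
≤-<-trans = NonStrict.≤-<-trans sym <-trans (proj₂ (resp₂ _<ᵀ_))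

≤⇒≯ : ∀ {a b} → a ≤ᵀ b → ¬ (b <ᵀ a)
≤⇒≯ (inj₁ a<b) = <-asym a<b
≤⇒≯ (inj₂ refl) = <-irrefl refl

≮⇒≥ : ∀ {a b} → ¬ (a <ᵀ b) → b ≤ᵀ a
≮⇒≥ {a} {b} a≮b with <-cmp a b
... | tri< a<b _ _ = ⊥-elim (a≮b a<b)
... | tri≈ _ refl _ = inj₂ refl
... | tri> _ _ b<a = inj₁ b<a

𝟎≤ : ∀ a → 𝟎 ≤ᵀ a
𝟎≤ 𝟎 = inj₂ refl
𝟎≤ (ω^ _ + _) = inj₁ <₁

≮𝟎 : ∀ {a} → ¬ (a <ᵀ 𝟎)
≮𝟎 ()

≤𝟎⇒≡𝟎 : ∀ {a} → a ≤ᵀ 𝟎 → a ≡ 𝟎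
≤𝟎⇒≡𝟎 (inj₂ a≡𝟎) = a≡𝟎

ω^+-monoʳ-≤ : ∀ {a c d} → c ≤ᵀ d → ω^ a + c ≤ᵀ ω^ a + d
ω^+-monoʳ-≤ (inj₁ c<d) = inj₁ (<₃ c<d)
ω^+-monoʳ-≤ (inj₂ refl) = inj₂ refl

left-mono-≤ : ∀ {a b} → a ≤ᵀ b → left a ≤ᵀ left b
left-mono-≤ (inj₁ (<₁ {a})) = 𝟎≤ a
left-mono-≤ (inj₁ (<₂ p)) = inj₁ p
left-mono-≤ (inj₁ (<₃ _)) = inj₂ refl
left-mono-≤ (inj₂ refl) = inj₂ refl

<left⇒ω^+< : ∀ {a z} t → a <ᵀ left z → ω^ a + t <ᵀ z
<left⇒ω^+< {z = ω^ _ + _} t a<e = <₂ a<e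

left<⇒<ω^+ : ∀ {u h} t → left u <ᵀ h → u <ᵀ ω^ h + t
left<⇒<ω^+ {𝟎} t _ = <₁
left<⇒<ω^+ {ω^ _ + _} t p = <₂ p

tail< : ∀ {a b} → IsCnf (ω^ a + b) → b <ᵀ ω^ a + b
tail< {b = 𝟎} _ = <₁
tail< {b = ω^ e + f} (cnfω pa (cnfω pe pf l) (inj₁ e<a)) = <₂ e<a
tail< {b = ω^ e + f} (cnfω pa (cnfω pe pf l) (inj₂ refl)) = <₃ (tail< (cnfω pa pf l))

<-irrelevant : Binary.Irrelevant _<ᵀ_
<-irrelevant <₁ <₁ = refl
<-irrelevant (<₂ p) (<₂ q) = cong <₂ (<-irrelevant p q)
<-irrelevant (<₂ p) (<₃ _) = ⊥-elim (<-irrefl refl p)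
<-irrelevant (<₃ _) (<₂ q) = ⊥-elim (<-irrefl refl q)
<-irrelevant (<₃ p) (<₃ q) = cong <₃ (<-irrelevant p q)

≤-irrelevant : Binary.Irrelevant _≤ᵀ_
≤-irrelevant (inj₁ p) (inj₁ q) = cong inj₁ (<-irrelevant p q)
≤-irrelevant (inj₁ p) (inj₂ refl) = ⊥-elim (<-irrefl refl p)
≤-irrelevant (inj₂ refl) (inj₁ q) = ⊥-elim (<-irrefl refl q)
≤-irrelevant (inj₂ p) (inj₂ q) = cong inj₂ (UIP.Decidable⇒UIP.≡-irrelevant _≟_ p q)

IsCnf-irrelevant : Unary.Irrelevant IsCnf
IsCnf-irrelevant cnf𝟎 cnf𝟎 = refl
IsCnf-irrelevant (cnfω p q l) (cnfω p′ q′ l′)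
  rewrite IsCnf-irrelevant p p′ | IsCnf-irrelevant q q′ | ≤-irrelevant l l′ = refl

proj₁-injective : ∀ {x y : Cnf} → proj₁ x ≡ proj₁ y → x ≡ y
proj₁-injective {x , p} {.x , q} refl = cong (x ,_) (IsCnf-irrelevant p q)

-- Arithmetic on trees

infixl 6 _⊕_
infixl 7 _⊗_

-- The paper's clause x + 𝟎 = x is ⊕-identityʳ: for y = 𝟎 the test below fails.
_⊕_ : Tree → Tree → Tree
𝟎 ⊕ y = y
(ω^ a + c) ⊕ y with a <? left y
... | yes _ = y
... | no _ = ω^ a + (c ⊕ y)

ω^+⊕-absorbed : ∀ {a c y} → a <ᵀ left y → (ω^ a + c) ⊕ y ≡ y
ω^+⊕-absorbed {a} {c} {y} a<y with a <? left y
... | yes _ = refl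
... | no a≮y = ⊥-elim (a≮y a<y)

ω^+⊕-kept : ∀ {a c y} → ¬ (a <ᵀ left y) → (ω^ a + c) ⊕ y ≡ ω^ a + (c ⊕ y)
ω^+⊕-kept {a} {c} {y} a≮y with a <? left y
... | yes a<y = ⊥-elim (a≮y a<y)
... | no _ = refl

⊕-identityʳ : ∀ x → x ⊕ 𝟎 ≡ x
⊕-identityʳ 𝟎 = refl
⊕-identityʳ (ω^ a + c) = trans (ω^+⊕-kept (λ ())) (cong (ω^ a +_) (⊕-identityʳ c))

left-⊕-≤ : ∀ {m} x y → left x ≤ᵀ m → left y ≤ᵀ m → left (x ⊕ y) ≤ᵀ m
left-⊕-≤ 𝟎 y _ ly = ly
left-⊕-≤ (ω^ a + c) y lx ly with a <? left y
... | yes _ = ly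
... | no _ = lx

⊕-isCnf : ∀ {x y} → IsCnf x → IsCnf y → IsCnf (x ⊕ y)
⊕-isCnf cnf𝟎 py = py
⊕-isCnf {ω^ a + c} {y} (cnfω pa pc l) py with a <? left y
... | yes _ = py
... | no a≮y = cnfω pa (⊕-isCnf pc py) (left-⊕-≤ c y l (≮⇒≥ a≮y))

⊕-monoʳ-< : ∀ x {y z} → y <ᵀ z → x ⊕ y <ᵀ x ⊕ z
⊕-monoʳ-< 𝟎 y<z = y<z
⊕-monoʳ-< (ω^ a + c) {y} {z} y<z with a <? left y | a <? left z
... | yes _ | yes _ = y<z
... | yes a<y | no a≮z = ⊥-elim (a≮z (<-≤-trans a<y (left-mono-≤ (inj₁ y<z))))
... | no _ | yes a<z = <left⇒ω^+< _ a<z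
... | no _ | no _ = <₃ (⊕-monoʳ-< c y<z)

⊕-monoʳ-≤ : ∀ x {y z} → y ≤ᵀ z → x ⊕ y ≤ᵀ x ⊕ z
⊕-monoʳ-≤ x (inj₁ y<z) = inj₁ (⊕-monoʳ-< x y<z)
⊕-monoʳ-≤ x (inj₂ refl) = inj₂ refl

⊕-cancelˡ-< : ∀ x {y z} → x ⊕ y <ᵀ x ⊕ z → y <ᵀ z
⊕-cancelˡ-< x {y} {z} lt with <-cmp y z
... | tri< y<z _ _ = y<z
... | tri≈ _ refl _ = ⊥-elim (<-irrefl refl lt)
... | tri> _ _ z<y = ⊥-elim (<-asym lt (⊕-monoʳ-< x z<y))

x≤x⊕y : ∀ x y → x ≤ᵀ x ⊕ y
x≤x⊕y 𝟎 y = 𝟎≤ y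
x≤x⊕y (ω^ a + c) y with a <? left y
... | yes a<y = inj₁ (<left⇒ω^+< c a<y)
... | no _ = ω^+-monoʳ-≤ (x≤x⊕y c y)

y≤x⊕y : ∀ x {y} → IsCnf y → y ≤ᵀ x ⊕ y
y≤x⊕y 𝟎 _ = inj₂ refl
y≤x⊕y (ω^ a + c) {𝟎} _ = 𝟎≤ _
y≤x⊕y (ω^ a + c) {ω^ e + g} py with a <? e
... | yes _ = inj₂ refl
... | no a≮e with ≮⇒≥ a≮e
...   | inj₁ e<a = inj₁ (<₂ e<a)
...   | inj₂ refl = ω^+-monoʳ-≤ (inj₁ (<-≤-trans (tail< py) (y≤x⊕y c py)))

x<x⊕y : ∀ x {y} → 𝟎 <ᵀ y → x <ᵀ x ⊕ y
x<x⊕y x {y} 𝟎<y = subst (_<ᵀ x ⊕ y) (⊕-identityʳ x) (⊕-monoʳ-< x 𝟎<y)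

⊕-monoˡ-≤ : ∀ {y z} x → IsCnf x → y ≤ᵀ z → y ⊕ x ≤ᵀ z ⊕ x
⊕-monoˡ-≤ x px (inj₂ refl) = inj₂ refl
⊕-monoˡ-≤ x px (inj₁ (<₁ {e} {f})) = y≤x⊕y (ω^ e + f) px
⊕-monoˡ-≤ x px (inj₁ (<₂ {e} {f} {e′} {f′} e<e′)) with e <? left x | e′ <? left x
... | yes _ | yes _ = inj₂ refl
... | no e≮x | yes e′<x = ⊥-elim (e≮x (<-trans e<e′ e′<x))
... | no _ | no _ = inj₁ (<₂ e<e′)
... | yes e<x | no e′≮x = absorbed x px e<x e′≮x
  where
  absorbed : ∀ x → IsCnf x → e <ᵀ left x → ¬ (e′ <ᵀ left x) → x ≤ᵀ ω^ e′ + (f′ ⊕ x)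
  absorbed (ω^ g + h) px _ e′≮g with ≮⇒≥ e′≮g
  ... | inj₁ g<e′ = inj₁ (<₂ g<e′)
  ... | inj₂ refl = ω^+-monoʳ-≤ (inj₁ (<-≤-trans (tail< px) (y≤x⊕y f′ px)))
⊕-monoˡ-≤ x px (inj₁ (<₃ {e} f<f′)) with e <? left x
... | yes _ = inj₂ refl
... | no _ = ω^+-monoʳ-≤ (⊕-monoˡ-≤ x px (inj₁ f<f′))

≤⇒∃⊕ : ∀ {x z} → IsCnf x → IsCnf z → x ≤ᵀ z → Σ[ d ∈ Tree ] IsCnf d × x ⊕ d ≡ z
≤⇒∃⊕ {x} _ _ (inj₂ refl) = 𝟎 , cnf𝟎 , ⊕-identityʳ x
≤⇒∃⊕ {𝟎} {z} _ pz (inj₁ _) = z , pz , refl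
≤⇒∃⊕ {ω^ a + c} {ω^ e + f} _ pz (inj₁ (<₂ a<e)) = ω^ e + f , pz , ω^+⊕-absorbed a<e
≤⇒∃⊕ {ω^ a + c} {ω^ .a + f} (cnfω _ pc _) (cnfω _ pf lf) (inj₁ (<₃ c<f))
  with ≤⇒∃⊕ pc pf (inj₁ c<f)
... | d , pd , c⊕d≡f = d , pd , trans (ω^+⊕-kept a≮d) (cong (ω^ a +_) c⊕d≡f)
  where
  a≮d : ¬ (a <ᵀ left d)
  a≮d = ≤⇒≯ (≤-trans (left-mono-≤ (y≤x⊕y c pd)) (subst (λ t → left t ≤ᵀ a) (sym c⊕d≡f) lf))

sucᵀ : Tree → Tree
sucᵀ 𝟎 = 𝟏ᵀ
sucᵀ (ω^ a + b) = ω^ a + sucᵀ b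

left-sucᵀ : ∀ b → left (sucᵀ b) ≡ left b
left-sucᵀ 𝟎 = refl
left-sucᵀ (ω^ _ + _) = refl

sucᵀ-isCnf : ∀ {x} → IsCnf x → IsCnf (sucᵀ x)
sucᵀ-isCnf cnf𝟎 = cnfω cnf𝟎 cnf𝟎 (inj₂ refl)
sucᵀ-isCnf {ω^ a + b} (cnfω pa pb l) = cnfω pa (sucᵀ-isCnf pb) (subst (_≤ᵀ a) (sym (left-sucᵀ b)) l)

x<sucᵀx : ∀ x → x <ᵀ sucᵀ x
x<sucᵀx 𝟎 = <₁
x<sucᵀx (ω^ _ + b) = <₃ (x<sucᵀx b)

sucᵀ-least : ∀ {x z} → x <ᵀ z → sucᵀ x ≤ᵀ z
sucᵀ-least {𝟎} {ω^ 𝟎 + 𝟎} <₁ = inj₂ refl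
sucᵀ-least {𝟎} {ω^ 𝟎 + (ω^ _ + _)} <₁ = inj₁ (<₃ <₁)
sucᵀ-least {𝟎} {ω^ (ω^ _ + _) + _} <₁ = inj₁ (<₂ <₁)
sucᵀ-least (<₂ a<c) = inj₁ (<₂ a<c)
sucᵀ-least (<₃ b<d) = ω^+-monoʳ-≤ (sucᵀ-least b<d)

⊕-sucᵀ : ∀ c b → c ⊕ sucᵀ b ≡ sucᵀ (c ⊕ b)
⊕-sucᵀ 𝟎 b = refl
⊕-sucᵀ (ω^ e + f) b with e <? left b
... | yes e<b = ω^+⊕-absorbed (subst (e <ᵀ_) (sym (left-sucᵀ b)) e<b)
... | no e≮b = trans (ω^+⊕-kept (subst (λ t → ¬ (e <ᵀ t)) (sym (left-sucᵀ b)) e≮b))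
                     (cong (ω^ e +_) (⊕-sucᵀ f b))

x⊕𝟏ᵀ≡sucᵀx : ∀ x → x ⊕ 𝟏ᵀ ≡ sucᵀ x
x⊕𝟏ᵀ≡sucᵀx x = trans (⊕-sucᵀ x 𝟎) (cong sucᵀ (⊕-identityʳ x))

-- The finite clause is x · d + x, not the paper's x + x · d, to match the successor
-- equation c · (b + 1) = c · b + c.
_⊗_ : Tree → Tree → Tree
x ⊗ 𝟎 = 𝟎
x ⊗ (ω^ 𝟎 + d) = x ⊗ d ⊕ x
𝟎 ⊗ (ω^ (ω^ p + q) + d) = 𝟎
(ω^ a + c) ⊗ (ω^ (ω^ p + q) + d) = ω^ (a ⊕ ω^ p + q) + ((ω^ a + c) ⊗ d)

⊗-zeroˡ : ∀ y → 𝟎 ⊗ y ≡ 𝟎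
⊗-zeroˡ 𝟎 = refl
⊗-zeroˡ (ω^ 𝟎 + d) = cong (_⊕ 𝟎) (⊗-zeroˡ d)
⊗-zeroˡ (ω^ (ω^ _ + _) + _) = refl

⊗-sucᵀ : ∀ x b → x ⊗ sucᵀ b ≡ x ⊗ b ⊕ x
⊗-sucᵀ x 𝟎 = refl
⊗-sucᵀ x (ω^ 𝟎 + f) = cong (_⊕ x) (⊗-sucᵀ x f)
⊗-sucᵀ 𝟎 (ω^ (ω^ _ + _) + _) = refl
⊗-sucᵀ (ω^ a + c) (ω^ (ω^ p + q) + f) =
  trans (cong (ω^ (a ⊕ ω^ p + q) +_) (⊗-sucᵀ (ω^ a + c) f))
        (sym (ω^+⊕-kept (≤⇒≯ (x≤x⊕y a (ω^ p + q)))))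

left-⊗-≤ : ∀ a c {d} → IsCnf d → left ((ω^ a + c) ⊗ d) ≤ᵀ a ⊕ left d
left-⊗-≤ a c {𝟎} _ = 𝟎≤ _
left-⊗-≤ a c {ω^ 𝟎 + d} (cnfω _ pd ld) =
  left-⊕-≤ ((ω^ a + c) ⊗ d) (ω^ a + c)
    (subst (λ t → left ((ω^ a + c) ⊗ d) ≤ᵀ a ⊕ t) (≤𝟎⇒≡𝟎 ld) (left-⊗-≤ a c pd))
    (inj₂ (sym (⊕-identityʳ a)))
left-⊗-≤ a c {ω^ (ω^ _ + _) + _} _ = inj₂ refl

left-⊗-finite : ∀ a c {d} → IsCnf d → left d ≤ᵀ 𝟎 → left ((ω^ a + c) ⊗ d) ≤ᵀ a
left-⊗-finite a c {d} pd ld =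
  subst (left ((ω^ a + c) ⊗ d) ≤ᵀ_) (trans (cong (a ⊕_) (≤𝟎⇒≡𝟎 ld)) (⊕-identityʳ a))
        (left-⊗-≤ a c pd)

⊗-isCnf : ∀ {x y} → IsCnf x → IsCnf y → IsCnf (x ⊗ y)
⊗-isCnf px cnf𝟎 = cnf𝟎
⊗-isCnf px (cnfω {𝟎} _ pd _) = ⊕-isCnf (⊗-isCnf px pd) px
⊗-isCnf cnf𝟎 (cnfω {ω^ _ + _} _ _ _) = cnf𝟎
⊗-isCnf {ω^ a + c} px@(cnfω pa _ _) (cnfω {ω^ p + q} pe pd ld) =
  cnfω (⊕-isCnf pa pe) (⊗-isCnf px pd) (≤-trans (left-⊗-≤ a c pd) (⊕-monoʳ-≤ a ld))

⊗-monoʳ-≤ : ∀ x {y z} → IsCnf x → IsCnf y → IsCnf z → y ≤ᵀ z → x ⊗ y ≤ᵀ x ⊗ z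
⊗-monoʳ-≤ 𝟎 {y} {z} _ _ _ _ = inj₂ (trans (⊗-zeroˡ y) (sym (⊗-zeroˡ z)))
⊗-monoʳ-≤ (ω^ a + c) _ _ _ (inj₂ refl) = inj₂ refl
⊗-monoʳ-≤ (ω^ a + c) _ _ _ (inj₁ <₁) = 𝟎≤ _
⊗-monoʳ-≤ (ω^ a + c) _ (cnfω _ pf lf) _ (inj₁ (<₂ {𝟎} {f} {ω^ p + q} _)) =
  inj₁ (left<⇒<ω^+ _ (≤-<-trans
    (left-⊕-≤ ((ω^ a + c) ⊗ f) (ω^ a + c) (left-⊗-finite a c pf lf) (inj₂ refl))
    (x<x⊕y a <₁)))
⊗-monoʳ-≤ (ω^ a + c) _ _ _ (inj₁ (<₂ {ω^ _ + _} {_} {ω^ _ + _} e<e′)) =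
  inj₁ (<₂ (⊕-monoʳ-< a e<e′))
⊗-monoʳ-≤ x@(ω^ _ + _) px (cnfω _ pf _) (cnfω _ pg _) (inj₁ (<₃ {𝟎} f<g)) =
  ⊕-monoˡ-≤ x px (⊗-monoʳ-≤ x px pf pg (inj₁ f<g))
⊗-monoʳ-≤ x@(ω^ _ + _) px (cnfω _ pf _) (cnfω _ pg _) (inj₁ (<₃ {ω^ _ + _} f<g)) =
  ω^+-monoʳ-≤ (⊗-monoʳ-≤ x px pf pg (inj₁ f<g))

-- Approximating a product from below

infixr 30 ω^_·ℕ_
ω^_·ℕ_ : Tree → ℕ → Tree
ω^ u ·ℕ zero = 𝟎
ω^ u ·ℕ suc n = ω^ u + ω^ u ·ℕ n

length : Tree → ℕ
length 𝟎 = zero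
length (ω^ _ + b) = suc (length b)

left-ω^·ℕ : ∀ u n → left (ω^ u ·ℕ n) ≤ᵀ u
left-ω^·ℕ u zero = 𝟎≤ u
left-ω^·ℕ u (suc n) = inj₂ refl

ω^·ℕ-isCnf : ∀ {u} → IsCnf u → ∀ n → IsCnf (ω^ u ·ℕ n)
ω^·ℕ-isCnf pu zero = cnf𝟎
ω^·ℕ-isCnf {u} pu (suc n) = cnfω pu (ω^·ℕ-isCnf pu n) (left-ω^·ℕ u n)

<ω^·ℕ-suc-length : ∀ {z g} → IsCnf z → left z ≤ᵀ g → z <ᵀ ω^ g ·ℕ suc (length z)
<ω^·ℕ-suc-length cnf𝟎 _ = <₁
<ω^·ℕ-suc-length (cnfω _ _ _) (inj₁ a<g) = <₂ a<g
<ω^·ℕ-suc-length (cnfω _ pb lb) (inj₂ refl) = <₃ (<ω^·ℕ-suc-length pb lb)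

ω^·ℕ-suc-≤-⊕ : ∀ {u c} → IsCnf (ω^ u + c) → ∀ k {y} →
               ω^ u ·ℕ k ≤ᵀ y → ω^ u ·ℕ suc k ≤ᵀ y ⊕ ω^ u + c
ω^·ℕ-suc-≤-⊕ px zero {y} _ = ≤-trans (ω^+-monoʳ-≤ (𝟎≤ _)) (y≤x⊕y y px)
ω^·ℕ-suc-≤-⊕ _ (suc k) (inj₁ (<₂ u<g)) =
  ≤-trans (inj₁ (<₂ u<g)) (inj₂ (sym (ω^+⊕-kept (<-asym u<g))))
ω^·ℕ-suc-≤-⊕ px (suc k) (inj₁ (<₃ lt)) =
  ≤-trans (ω^+-monoʳ-≤ (ω^·ℕ-suc-≤-⊕ px k (inj₁ lt)))
          (inj₂ (sym (ω^+⊕-kept {y = ω^ _ + _} (<-irrefl refl))))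
ω^·ℕ-suc-≤-⊕ px (suc k) (inj₂ refl) =
  ≤-trans (ω^+-monoʳ-≤ (ω^·ℕ-suc-≤-⊕ px k (inj₂ refl)))
          (inj₂ (sym (ω^+⊕-kept {y = ω^ _ + _} (<-irrefl refl))))

ω^⊕·ℕ≤⊗ω^·ℕ : ∀ {v c} → IsCnf (ω^ v + c) → ∀ u k → ω^ (v ⊕ u) ·ℕ k ≤ᵀ (ω^ v + c) ⊗ ω^ u ·ℕ k
ω^⊕·ℕ≤⊗ω^·ℕ {v} {c} px 𝟎 k rewrite ⊕-identityʳ v = finite k
  where
  finite : ∀ k → ω^ v ·ℕ k ≤ᵀ (ω^ v + c) ⊗ ω^ 𝟎 ·ℕ k
  finite zero = inj₂ refl
  finite (suc k) = ω^·ℕ-suc-≤-⊕ px k (finite k)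
ω^⊕·ℕ≤⊗ω^·ℕ {v} {c} _ (ω^ p + q) k = inj₂ (sym (infinite k))
  where
  infinite : ∀ k → (ω^ v + c) ⊗ ω^ (ω^ p + q) ·ℕ k ≡ ω^ (v ⊕ ω^ p + q) ·ℕ k
  infinite zero = refl
  infinite (suc k) = cong (ω^ (v ⊕ ω^ p + q) +_) (infinite k)

-- For x = ω^ v + c and z = ω^ g + h: g = v ⊕ u for some u < E, so
-- z < ω^ (v ⊕ u) ·ℕ (length z + 1) ≤ x ⊗ ω^ u ·ℕ (length z + 1).
≥-<ω^⊕⇒<⊗sucᵀ : ∀ {v c E g h} → IsCnf (ω^ v + c) → IsCnf (ω^ g + h) →
                ω^ v + c ≤ᵀ ω^ g + h → g <ᵀ v ⊕ E →
                Σ[ q ∈ Tree ] IsCnf q × left q <ᵀ E × ω^ g + h <ᵀ (ω^ v + c) ⊗ sucᵀ q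
≥-<ω^⊕⇒<⊗sucᵀ {v} {c} {E} {g} {h} px@(cnfω pv _ _) pz@(cnfω pg _ _) x≤z g<v⊕E
  with ≤⇒∃⊕ pv pg (left-mono-≤ x≤z)
... | u , pu , v⊕u≡g = q , pq , u<E , z<x⊗q+1
  where
  n : ℕ
  n = length (ω^ g + h)
  q : Tree
  q = ω^ u ·ℕ suc n
  pq : IsCnf q
  pq = ω^·ℕ-isCnf pu (suc n)
  u<E : u <ᵀ E
  u<E = ⊕-cancelˡ-< v (subst (_<ᵀ v ⊕ E) (sym v⊕u≡g) g<v⊕E)
  z<x⊗q+1 : ω^ g + h <ᵀ (ω^ v + c) ⊗ sucᵀ q
  z<x⊗q+1 = <-≤-trans
    (subst (λ t → ω^ g + h <ᵀ ω^ t ·ℕ suc n) (sym v⊕u≡g) (<ω^·ℕ-suc-length pz (inj₂ refl)))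
    (≤-trans (ω^⊕·ℕ≤⊗ω^·ℕ px u (suc n))
             (⊗-monoʳ-≤ (ω^ v + c) px pq (sucᵀ-isCnf pq) (inj₁ (x<sucᵀx q))))

<⊗⇒<⊗sucᵀ : ∀ {x a z} → IsCnf x → IsCnf a → IsCnf z → z <ᵀ x ⊗ a →
            Σ[ q ∈ Tree ] IsCnf q × q <ᵀ a × z <ᵀ x ⊗ sucᵀ q
<⊗⇒<⊗sucᵀ {x} {ω^ 𝟎 + d} {z} _ pa@(cnfω _ pd _) _ z<x⊗a =
  d , pd , tail< pa , subst (z <ᵀ_) (sym (⊗-sucᵀ x d)) z<x⊗a
<⊗⇒<⊗sucᵀ {ω^ _ + _} {ω^ (ω^ _ + _) + _} {𝟎} _ _ _ _ = 𝟎 , cnf𝟎 , <₁ , <₁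
<⊗⇒<⊗sucᵀ {x@(ω^ _ + _)} {ω^ (ω^ _ + _) + _} {z@(ω^ _ + _)} px _ pz (<₂ g<v⊕E) with z <? x
... | yes z<x = 𝟎 , cnf𝟎 , <₁ , z<x
... | no z≮x with ≥-<ω^⊕⇒<⊗sucᵀ px pz (≮⇒≥ z≮x) g<v⊕E
...   | q , pq , q<E , z<x⊗q+1 = q , pq , left<⇒<ω^+ _ q<E , z<x⊗q+1
<⊗⇒<⊗sucᵀ {ω^ _ + _} {ω^ E@(ω^ _ + _) + d} px (cnfω pE pd ld) (cnfω _ ph _) (<₃ h<x⊗d)
  with <⊗⇒<⊗sucᵀ px pd ph h<x⊗d
... | q , pq , q<d , h<x⊗q+1 =
  ω^ E + q , cnfω pE pq (≤-trans (left-mono-≤ (inj₁ q<d)) ld) , <₃ q<d , <₃ h<x⊗q+1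

-- Arithmetic on Cnf and its continuity

open Characterisation _<_ _≤_

𝟎ᶜ : Cnf
𝟎ᶜ = 𝟎 , cnf𝟎

infixl 6 _+ᶜ_
infixl 7 _·ᶜ_

_+ᶜ_ : Cnf → Cnf → Cnf
(x , px) +ᶜ (y , py) = x ⊕ y , ⊕-isCnf px py

_·ᶜ_ : Cnf → Cnf → Cnf
(x , px) ·ᶜ (y , py) = x ⊗ y , ⊗-isCnf px py

sucᶜ : Cnf → Cnf
sucᶜ (x , px) = sucᵀ x , sucᵀ-isCnf px

infix 30 ω^ᶜ_
ω^ᶜ_ : Cnf → Cnf
ω^ᶜ (x , px) = ω^ x + 𝟎 , cnfω px cnf𝟎 (𝟎≤ x)

ℕᶜ : ℕ → Cnf
ℕᶜ n = ω^ 𝟎 ·ℕ n , ω^·ℕ-isCnf cnf𝟎 n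

IsZero⇒≡𝟎 : ∀ {a} → IsZero a → proj₁ a ≡ 𝟎
IsZero⇒≡𝟎 a-zero = ≤𝟎⇒≡𝟎 (a-zero 𝟎ᶜ)

𝟎<⇒¬IsZero : ∀ a → 𝟎 <ᵀ proj₁ a → ¬ IsZero a
𝟎<⇒¬IsZero a 𝟎<a a-zero = <-irrefl (sym (IsZero⇒≡𝟎 {a} a-zero)) 𝟎<a

≤ᶜ-antisym : ∀ {x y} → x ≤ y → y ≤ x → x ≡ y
≤ᶜ-antisym x≤y y≤x = proj₁-injective (≤-antisym x≤y y≤x)

sucᶜ-isSuc : ∀ a → IsSuc (sucᶜ a) a
sucᶜ-isSuc (a , _) = x<sucᵀx a , λ _ → sucᵀ-least

open Successors ≤ᶜ-antisym sucᶜ sucᶜ-isSuc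

ω^+𝟎≤ω^+ : ∀ {a b c} → a ≤ᵀ b → ω^ a + 𝟎 ≤ᵀ ω^ b + c
ω^+𝟎≤ω^+ (inj₁ a<b) = inj₁ (<₂ a<b)
ω^+𝟎≤ω^+ (inj₂ refl) = ω^+-monoʳ-≤ (𝟎≤ _)

+ᶜ-preserves-IsSup : ∀ c {a f} → IsSup a f → IsSup (c +ᶜ a) (λ i → c +ᶜ f i)
+ᶜ-preserves-IsSup (c , pc) {a} {f} (upper , least) = (λ i → ⊕-monoʳ-≤ c (upper i)) , least′
  where
  least′ : ∀ z → (∀ i → ((c , pc) +ᶜ f i) ≤ z) → ((c , pc) +ᶜ a) ≤ z
  least′ (z , pz) c+f≤z with ≤⇒∃⊕ pc pz (≤-trans (x≤x⊕y c (proj₁ (f 0))) (c+f≤z 0))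
  ... | d , pd , c⊕d≡z = subst (c ⊕ proj₁ a ≤ᵀ_) c⊕d≡z (⊕-monoʳ-≤ c (least (d , pd) f≤d))
    where
    f≤d : ∀ i → f i ≤ (d , pd)
    f≤d i = ≮⇒≥ λ d<fi →
      ≤⇒≯ (c+f≤z i) (subst (_<ᵀ c ⊕ proj₁ (f i)) c⊕d≡z (⊕-monoʳ-< c d<fi))

·ᶜ-preserves-IsSup : ∀ c {a f} → IsSup a f → IsSup (c ·ᶜ a) (λ i → c ·ᶜ f i)
·ᶜ-preserves-IsSup (c , pc) {a , pa} {f} (upper , least) =
  (λ i → ⊗-monoʳ-≤ c pc (proj₂ (f i)) pa (upper i)) , least′
  where
  least′ : ∀ z → (∀ i → ((c , pc) ·ᶜ f i) ≤ z) → c ⊗ a ≤ᵀ proj₁ z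
  least′ (z , pz) c·f≤z = ≮⇒≥ z≮c·a
    where
    z≮c·a : ¬ (z <ᵀ c ⊗ a)
    z≮c·a z<c·a with <⊗⇒<⊗sucᵀ pc pa pz z<c·a
    ... | q , pq , q<a , z<c·q+1 = ≤⇒≯ (least (q , pq) f≤q) q<a
      where
      f≤q : ∀ i → f i ≤ (q , pq)
      f≤q i = ≮⇒≥ λ q<fi → ≤⇒≯
        (≤-trans (⊗-monoʳ-≤ c pc (sucᵀ-isCnf pq) (proj₂ (f i)) (sucᵀ-least q<fi)) (c·f≤z i))
        z<c·q+1

ω^ᶜ-preserves-IsSup : ∀ {a f} → IsSup a f → IsSup (ω^ᶜ a) (λ i → ω^ᶜ (f i))
ω^ᶜ-preserves-IsSup {a} {f} (upper , least) = (λ i → ω^+𝟎≤ω^+ (upper i)) , least′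
  where
  least′ : ∀ z → (∀ i → ω^ᶜ (f i) ≤ z) → ω^ᶜ a ≤ z
  least′ (𝟎 , _) ω^f≤z with ω^f≤z 0
  ... | inj₁ ()
  ... | inj₂ ()
  least′ (ω^ g + h , cnfω pg _ _) ω^f≤z = ω^+𝟎≤ω^+ (least (g , pg) (λ i → left-mono-≤ (ω^f≤z i)))

<ω⇒left≤𝟎 : ∀ {z} → z <ᵀ proj₁ ω → left z ≤ᵀ 𝟎
<ω⇒left≤𝟎 <₁ = inj₂ refl
<ω⇒left≤𝟎 (<₂ <₁) = inj₂ refl

ω-isSup-ℕᶜ : IsSup ω ℕᶜ
ω-isSup-ℕᶜ = (λ n → inj₁ (left<⇒<ω^+ 𝟎 (≤-<-trans (left-ω^·ℕ 𝟎 n) <₁))) , least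
  where
  least : ∀ z → (∀ n → ℕᶜ n ≤ z) → ω ≤ z
  least (z , pz) ℕ≤z = ≮⇒≥ λ z<ω →
    ≤⇒≯ (ℕ≤z (suc (length z))) (<ω^·ℕ-suc-length pz (<ω⇒left≤𝟎 z<ω))

+ᶜ-identityʳ : ∀ a c → IsZero a → c +ᶜ a ≡ c
+ᶜ-identityʳ a (c , _) a-zero =
  proj₁-injective (trans (cong (c ⊕_) (IsZero⇒≡𝟎 {a} a-zero)) (⊕-identityʳ c))

+ᶜ-sucᶜ : ∀ c b → c +ᶜ sucᶜ b ≡ sucᶜ (c +ᶜ b)
+ᶜ-sucᶜ (c , _) (b , _) = proj₁-injective (⊕-sucᵀ c b)

+ᶜ-continuous : ∀ c → Continuous (c +ᶜ_)
+ᶜ-continuous c a f (_ , a-sup) = +ᶜ-preserves-IsSup c {a} {f} a-sup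

·ᶜ-zeroʳ : ∀ a c → IsZero a → c ·ᶜ a ≡ a
·ᶜ-zeroʳ a (c , _) a-zero = proj₁-injective (trans (cong (c ⊗_) a≡𝟎) (sym a≡𝟎))
  where
  a≡𝟎 : proj₁ a ≡ 𝟎
  a≡𝟎 = IsZero⇒≡𝟎 {a} a-zero

·ᶜ-sucᶜ : ∀ c b → c ·ᶜ sucᶜ b ≡ c ·ᶜ b +ᶜ c
·ᶜ-sucᶜ (c , _) (b , _) = proj₁-injective (⊗-sucᵀ c b)

·ᶜ-continuous : ∀ c → Continuous (c ·ᶜ_)
·ᶜ-continuous c a f (_ , a-sup) = ·ᶜ-preserves-IsSup c {a} {f} a-sup

ω^ᶜ-zero : ∀ b → IsZero b → ω^ᶜ b ≡ sucᶜ b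
ω^ᶜ-zero b b-zero = proj₁-injective (trans (cong (ω^_+ 𝟎) b≡𝟎) (cong sucᵀ (sym b≡𝟎)))
  where
  b≡𝟎 : proj₁ b ≡ 𝟎
  b≡𝟎 = IsZero⇒≡𝟎 {b} b-zero

ω^ᶜ-continuous : Continuous ω^ᶜ_
ω^ᶜ-continuous a f (_ , a-sup) = ω^ᶜ-preserves-IsSup {a} {f} a-sup

-- Classification and well-foundedness

+ᶜ-isSuc : ∀ c {a b} → IsSuc a b → IsSuc (c +ᶜ a) (c +ᶜ b)
+ᶜ-isSuc c {a} {b} a-suc = subst (λ x → IsSuc x (c +ᶜ b)) (sym c+a≡suc[c+b]) (sucᶜ-isSuc (c +ᶜ b))
  where
  c+a≡suc[c+b] : c +ᶜ a ≡ sucᶜ (c +ᶜ b)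
  c+a≡suc[c+b] = trans (cong (c +ᶜ_) (isSuc⇒≡succ {a} {b} a-suc)) (+ᶜ-sucᶜ c b)

+ᶜ-isLimit : ∀ c {a f} → IsLimit a f → IsLimit (c +ᶜ a) (λ i → c +ᶜ f i)
+ᶜ-isLimit c {a} {f} (increasing , sup) =
  (λ i → ⊕-monoʳ-< (proj₁ c) (increasing i)) , +ᶜ-preserves-IsSup c {a} {f} sup

ω^ᶜ-isLimit : ∀ {a f} → IsLimit a f → IsLimit (ω^ᶜ a) (λ i → ω^ᶜ (f i))
ω^ᶜ-isLimit {a} {f} (increasing , sup) =
  (λ i → <₂ (increasing i)) , ω^ᶜ-preserves-IsSup {a} {f} sup

ω^ᶜ-sucᶜ : ∀ a → ω^ᶜ sucᶜ a ≡ ω^ᶜ a ·ᶜ ω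
ω^ᶜ-sucᶜ (a , _) = proj₁-injective (cong (ω^_+ 𝟎) (sym (x⊕𝟏ᵀ≡sucᵀx a)))

ω^ᶜsucᶜ-isLimit : ∀ a → IsLimit (ω^ᶜ sucᶜ a) (λ n → ω^ᶜ a ·ᶜ ℕᶜ n)
ω^ᶜsucᶜ-isLimit a@(t , _) =
  (λ n → x<x⊕y (proj₁ (ω^ᶜ a ·ᶜ ℕᶜ n)) {ω^ t + 𝟎} <₁) ,
  subst (λ x → IsSup x (λ n → ω^ᶜ a ·ᶜ ℕᶜ n)) (sym (ω^ᶜ-sucᶜ a))
        (·ᶜ-preserves-IsSup (ω^ᶜ a) {ω} {ℕᶜ} ω-isSup-ℕᶜ)

classification-+ᶜ : ∀ c {a} → 𝟎 <ᵀ proj₁ a → Classification a → Classification (c +ᶜ a)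
classification-+ᶜ c {a} 𝟎<a (isZero a-zero) = ⊥-elim (𝟎<⇒¬IsZero a 𝟎<a a-zero)
classification-+ᶜ c {a} _ (isSuc b a-suc) = isSuc (c +ᶜ b) (+ᶜ-isSuc c {a} {b} a-suc)
classification-+ᶜ c {a} _ (isLimit f a-limit) =
  isLimit (λ i → c +ᶜ f i) (+ᶜ-isLimit c {a} {f} a-limit)

classify : ∀ a → Classification a
classify (𝟎 , _) = isZero (λ b → 𝟎≤ (proj₁ b))
classify (ω^ 𝟎 + 𝟎 , _) = isSuc 𝟎ᶜ (sucᶜ-isSuc 𝟎ᶜ)
classify (ω^ e@(ω^ _ + _) + 𝟎 , cnfω pe _ _) with classify (e , pe)
... | isZero e-zero = ⊥-elim (𝟎<⇒¬IsZero (e , pe) <₁ e-zero)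
... | isSuc d e-suc = isLimit (λ n → ω^ᶜ d ·ᶜ ℕᶜ n)
  (subst (λ x → IsLimit (ω^ᶜ x) (λ n → ω^ᶜ d ·ᶜ ℕᶜ n))
         (sym (isSuc⇒≡succ {e , pe} {d} e-suc)) (ω^ᶜsucᶜ-isLimit d))
... | isLimit f e-limit = isLimit (λ i → ω^ᶜ f i) (ω^ᶜ-isLimit {e , pe} {f} e-limit)
classify (ω^ a + b@(ω^ _ + _) , cnfω pa pb lb) =
  subst Classification (proj₁-injective (ω^+⊕-kept (≤⇒≯ lb)))
        (classification-+ᶜ (ω^ᶜ (a , pa)) <₁ (classify (b , pb)))

-- The first descent below needs IsCnf (through tail<): on all trees, _<ᵀ_ is not well-founded.
mutual
  ω^+-acc : ∀ {a b} (pa : IsCnf a) (pb : IsCnf b) (p : IsCnf (ω^ a + b)) →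
            Acc _<_ (a , pa) → Acc _<_ (b , pb) → Acc _<_ (ω^ a + b , p)
  ω^+-acc pa pb _ acc-a acc-b = acc λ {z} z<ab → <ω^+-acc pa pb acc-a acc-b (proj₂ z) z<ab

  <ω^+-acc : ∀ {a b} (pa : IsCnf a) (pb : IsCnf b) → Acc _<_ (a , pa) → Acc _<_ (b , pb) →
          ∀ {z} (pz : IsCnf z) → z <ᵀ ω^ a + b → Acc _<_ (z , pz)
  <ω^+-acc _ _ _ _ cnf𝟎 _ = acc λ z<𝟎 → ⊥-elim (≮𝟎 z<𝟎)
  <ω^+-acc pa pb (acc below-a) acc-b pz@(cnfω pc pd _) (<₂ c<a) =
    ω^+-acc pc pd pz (below-a c<a)
      (<ω^+-acc pa pb (acc below-a) acc-b pd (<-trans (tail< pz) (<₂ c<a)))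
  <ω^+-acc pa pb acc-a (acc below-b) pz@(cnfω _ pd _) (<₃ d<b) =
    ω^+-acc pa pd pz acc-a (below-b d<b)

<-wellFounded : WellFounded _<_
<-wellFounded (𝟎 , _) = acc λ z<𝟎 → ⊥-elim (≮𝟎 z<𝟎)
<-wellFounded (ω^ a + b , p@(cnfω pa pb _)) =
  ω^+-acc pa pb p (<-wellFounded (a , pa)) (<-wellFounded (b , pb))

open Uniqueness <-≤-trans <-wellFounded classify

theorem5p10 : HasUniqueAddition × HasUniqueMultiplication × HasUniqueExponentiation ω
theorem5p10 = addition , multiplication , exponentiation
  where
  addition : HasUniqueAddition
  addition = hasUniqueAddition _+ᶜ_ +ᶜ-identityʳ +ᶜ-sucᶜ +ᶜ-continuous

  multiplication : HasUniqueMultiplication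
  multiplication = hasUniqueMultiplication addition _·ᶜ_ ·ᶜ-zeroʳ ·ᶜ-sucᶜ ·ᶜ-continuous

  exponentiation : HasUniqueExponentiation ω
  exponentiation = hasUniqueExponentiation multiplication ω (𝟎<⇒¬IsZero ω <₁)
    ω^ᶜ_ ω^ᶜ-zero ω^ᶜ-sucᶜ ω^ᶜ-continuous
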